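{- (i) If there exists a set of $s$ mutually orthogoval projective planes of order $q$, then $s\le \max\{5,q+2\}$. (ii) If there exists a set of $s$ mutually orthogoval affine planes of order $q>2$, then $s\le\max\{7,q+2\}$.
   Context: Two planes, both projective or both affine, of the same order and on the same point set are called orthogoval if every line of one plane intersects every line of the other in at most two points; a set of planes is mutually orthogoval if pairwise orthogoval. Here $q\ge 2$ is an integer (the order of the planes). -}

module Defs where

open import Data.Nat using (ℕ; suc)
open import Data.Fin using (Fin)
open import Data.Fin.Subset using (Subset; _∈_; _∉_; _∩_; ∣_∣)
open import Data.List using (List)
open import Data.List.Membership.Propositional using () renaming (_∈_ to _∈ₗ_)
open import Data.List.Relation.Unary.Unique.Propositional using (Unique)
open import Data.Product using (_×_; ∃)
open import Data.Empty using (⊥)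
open import Relation.Binary.PropositionalEquality using (_≡_; _≢_)
open import Relation.Nullary using (¬_)

Plane : ℕ → Set
Plane n = List (Subset n)

module _ {n : ℕ} where

  UniqueLineAxiom : Plane n → Set
  UniqueLineAxiom L =
    ∀ (x y : Fin n) → x ≢ y →
      (∃ λ ℓ → ℓ ∈ₗ L × x ∈ ℓ × y ∈ ℓ) ×
      (∀ ℓ ℓ′ → ℓ ∈ₗ L → ℓ′ ∈ₗ L → x ∈ ℓ → y ∈ ℓ → x ∈ ℓ′ → y ∈ ℓ′ → ℓ ≡ ℓ′)

  Collinear : Plane n → Fin n → Fin n → Fin n → Set
  Collinear L x y z = ∃ λ ℓ → ℓ ∈ₗ L × x ∈ ℓ × y ∈ ℓ × z ∈ ℓ

  LinesOfSize : ℕ → Plane n → Set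
  LinesOfSize k L = ∀ ℓ → ℓ ∈ₗ L → ∣ ℓ ∣ ≡ k

  record IsProjectivePlane (q : ℕ) (L : Plane n) : Set where
    field
      distinctLines : Unique L
      joinAxiom     : UniqueLineAxiom L
      meetAxiom     : ∀ ℓ ℓ′ → ℓ ∈ₗ L → ℓ′ ∈ₗ L → ℓ ≢ ℓ′ → ∣ ℓ ∩ ℓ′ ∣ ≡ 1
      quadrangle    : ∃ λ (x : Fin n) → ∃ λ y → ∃ λ z → ∃ λ w →
                        (x ≢ y × x ≢ z × x ≢ w × y ≢ z × y ≢ w × z ≢ w) ×
                        ¬ Collinear L x y z × ¬ Collinear L x y w ×
                        ¬ Collinear L x z w × ¬ Collinear L y z w
      order         : LinesOfSize (suc q) L

  record IsAffinePlane (q : ℕ) (L : Plane n) : Set where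
    field
      distinctLines : Unique L
      joinAxiom     : UniqueLineAxiom L
      parallelAxiom : ∀ (p : Fin n) ℓ → ℓ ∈ₗ L → p ∉ ℓ →
                        (∃ λ m → m ∈ₗ L × p ∈ m × ∣ ℓ ∩ m ∣ ≡ 0) ×
                        (∀ m m′ → m ∈ₗ L → m′ ∈ₗ L → p ∈ m → p ∈ m′ →
                           ∣ ℓ ∩ m ∣ ≡ 0 → ∣ ℓ ∩ m′ ∣ ≡ 0 → m ≡ m′)
      triangle      : ∃ λ (x : Fin n) → ∃ λ y → ∃ λ z →
                        (x ≢ y × x ≢ z × y ≢ z) × ¬ Collinear L x y z
      order         : LinesOfSize q L

  Orthogoval : Plane n → Plane n → Set
  Orthogoval L M = ∀ ℓ m → ℓ ∈ₗ L → m ∈ₗ M → ∣ ℓ ∩ m ∣ Data.Nat.≤ 2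

  MutuallyOrthogoval : {s : ℕ} → (Fin s → Plane n) → Set
  MutuallyOrthogoval {s} P = ∀ (i j : Fin s) → i ≢ j → Orthogoval (P i) (P j)

-- Fix points x ≠ y and take, in each of the s planes, the line through them.
-- Orthogovality forces any two of these lines to meet exactly in {x, y}, so for
-- lines of size k their remaining points form s disjoint sets and
-- 2 + s(k − 2) ≤ n.  Conversely, the lines through a point x off a line m cover
-- all points and meet m in disjoint sets, all non-empty in a projective plane
-- and all but the parallel one in an affine plane; so there are at most q + 1
-- of them, whence n ≤ 1 + (q + 1)q, resp. n ≤ 1 + (q + 1)(q − 1).  Comparing the
-- two bounds gives s ≤ q + 2, except for small q where the constants 5 and 7
-- take over.
{-# OPTIONS --safe #-}
module Submission where

open import Defs
open import Data.Nat using (ℕ; zero; suc; _≤_; _<_; _+_; _*_; _⊔_; z≤n; s≤s; s≤s⁻¹)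
open import Data.Nat.Properties
open import Data.Nat.Tactic.RingSolver using (solve-∀)
open import Data.Fin using (Fin; zero)
open import Data.Fin.Subset
open import Data.Fin.Subset.Properties
open import Data.Vec using ([]; _∷_; here; there)
open import Data.List using (List; []; _∷_; map; length; filter; allFin)
open import Data.Nat.ListAction using (sum)
open import Data.List.Properties using (length-tabulate)
open import Data.List.Membership.Propositional using () renaming (_∈_ to _∈ₗ_)
open import Data.List.Membership.Propositional.Properties using (∈-filter⁺; ∈-filter⁻)
open import Data.List.Relation.Unary.All as All using (All; []; _∷_)
open import Data.List.Relation.Unary.AllPairs using ([]; _∷_)
open import Data.List.Relation.Unary.Any using () renaming (here to hereₗ; there to thereₗ)
open import Data.List.Relation.Unary.Unique.Propositional using (Unique)
open import Data.List.Relation.Unary.Unique.Propositional.Properties using (allFin⁺; filter⁺)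
open import Data.Product using (_×_; _,_; proj₁; proj₂; ∃)
open import Data.Sum using (inj₁; inj₂)
open import Data.Empty using (⊥-elim)
open import Function using (_∘_; id)
open import Relation.Binary.PropositionalEquality
open import Relation.Nullary using (¬_)

private variable
  A : Set
  n c q : ℕ
  x y z : Fin n
  p m : Subset n
  L : Plane n

x∈p─q⇒x∉q : ∀ (p q : Subset n) → x ∈ p ─ q → x ∉ q
x∈p─q⇒x∉q (_ ∷ p) (_      ∷ q) (there x∈p─q) (there x∈q) = x∈p─q⇒x∉q p q x∈p─q x∈q
x∈p─q⇒x∉q (_ ∷ p) (inside ∷ q) ()            here

x∈p-y⇒x≢y : x ∈ p - y → x ≢ y
x∈p-y⇒x≢y {p = p} {y = y} x∈p-y = x∉⁅y⁆⇒x≢y (x∈p─q⇒x∉q p ⁅ y ⁆ x∈p-y)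

x∈p⇒suc∣p-x∣≡∣p∣ : x ∈ p → suc ∣ p - x ∣ ≡ ∣ p ∣
x∈p⇒suc∣p-x∣≡∣p∣ {p = inside  ∷ p} here        = cong (suc ∘ ∣_∣) (p─⊥≡p p)
x∈p⇒suc∣p-x∣≡∣p∣ {p = inside  ∷ p} (there x∈p) = cong suc (x∈p⇒suc∣p-x∣≡∣p∣ x∈p)
x∈p⇒suc∣p-x∣≡∣p∣ {p = outside ∷ p} (there x∈p) = x∈p⇒suc∣p-x∣≡∣p∣ x∈p

x,y∈p⇒2+∣p-x-y∣≡∣p∣ : x ∈ p → y ∈ p → x ≢ y → 2 + ∣ p - x - y ∣ ≡ ∣ p ∣
x,y∈p⇒2+∣p-x-y∣≡∣p∣ x∈p y∈p x≢y =
  trans (cong suc (x∈p⇒suc∣p-x∣≡∣p∣ (x∈p∧x≢y⇒x∈p-y y∈p (≢-sym x≢y))))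
        (x∈p⇒suc∣p-x∣≡∣p∣ x∈p)

distinct-triple⇒3≤∣p∣ : x ∈ p → y ∈ p → z ∈ p → x ≢ y → x ≢ z → y ≢ z → 3 ≤ ∣ p ∣
distinct-triple⇒3≤∣p∣ {x = x} {p = p} {y = y} {z = z} x∈p y∈p z∈p x≢y x≢z y≢z = begin
  3                         ≤⟨ m≤m+n 3 _ ⟩
  3 + ∣ p - x - y - z ∣     ≡⟨ cong suc (x,y∈p⇒2+∣p-x-y∣≡∣p∣ y∈p-x z∈p-x y≢z) ⟩
  1 + ∣ p - x ∣             ≡⟨ x∈p⇒suc∣p-x∣≡∣p∣ x∈p ⟩
  ∣ p ∣                     ∎
  where
  open ≤-Reasoning
  y∈p-x : y ∈ p - x
  y∈p-x = x∈p∧x≢y⇒x∈p-y y∈p (≢-sym x≢y)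
  z∈p-x : z ∈ p - x
  z∈p-x = x∈p∧x≢y⇒x∈p-y z∈p (≢-sym x≢z)

∣p∪q∣+∣p∩q∣≡∣p∣+∣q∣ : ∀ (p q : Subset n) → ∣ p ∪ q ∣ + ∣ p ∩ q ∣ ≡ ∣ p ∣ + ∣ q ∣
∣p∪q∣+∣p∩q∣≡∣p∣+∣q∣ []            []            = refl
∣p∪q∣+∣p∩q∣≡∣p∣+∣q∣ (inside  ∷ p) (inside  ∷ q) = begin
  suc (∣ p ∪ q ∣ + suc ∣ p ∩ q ∣)   ≡⟨ cong suc (+-suc _ _) ⟩
  suc (suc (∣ p ∪ q ∣ + ∣ p ∩ q ∣)) ≡⟨ cong (2 +_) (∣p∪q∣+∣p∩q∣≡∣p∣+∣q∣ p q) ⟩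
  suc (suc (∣ p ∣ + ∣ q ∣))         ≡⟨ cong suc (+-suc _ _) ⟨
  suc (∣ p ∣ + suc ∣ q ∣)           ∎
  where open ≡-Reasoning
∣p∪q∣+∣p∩q∣≡∣p∣+∣q∣ (inside  ∷ p) (outside ∷ q) = cong suc (∣p∪q∣+∣p∩q∣≡∣p∣+∣q∣ p q)
∣p∪q∣+∣p∩q∣≡∣p∣+∣q∣ (outside ∷ p) (inside  ∷ q) =
  trans (cong suc (∣p∪q∣+∣p∩q∣≡∣p∣+∣q∣ p q)) (sym (+-suc _ _))
∣p∪q∣+∣p∩q∣≡∣p∣+∣q∣ (outside ∷ p) (outside ∷ q) = ∣p∪q∣+∣p∩q∣≡∣p∣+∣q∣ p q

∣p∪q∣≤∣p∣+∣q∣ : ∀ (p q : Subset n) → ∣ p ∪ q ∣ ≤ ∣ p ∣ + ∣ q ∣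
∣p∪q∣≤∣p∣+∣q∣ p q = ≤-trans (m≤m+n _ _) (≤-reflexive (∣p∪q∣+∣p∩q∣≡∣p∣+∣q∣ p q))

Empty[p∩q]⇒∣p∪q∣≡∣p∣+∣q∣ : ∀ (p q : Subset n) → Empty (p ∩ q) → ∣ p ∪ q ∣ ≡ ∣ p ∣ + ∣ q ∣
Empty[p∩q]⇒∣p∪q∣≡∣p∣+∣q∣ {n} p q p∩q-empty = begin
  ∣ p ∪ q ∣               ≡⟨ +-identityʳ _ ⟨
  ∣ p ∪ q ∣ + 0           ≡⟨ cong (∣ p ∪ q ∣ +_) ∣p∩q∣≡0 ⟨
  ∣ p ∪ q ∣ + ∣ p ∩ q ∣   ≡⟨ ∣p∪q∣+∣p∩q∣≡∣p∣+∣q∣ p q ⟩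
  ∣ p ∣ + ∣ q ∣           ∎
  where
  open ≡-Reasoning
  ∣p∩q∣≡0 : ∣ p ∩ q ∣ ≡ 0
  ∣p∩q∣≡0 = trans (cong ∣_∣ (Empty-unique p∩q-empty)) (∣⊥∣≡0 n)

module _ (f : A → ℕ) where

  sum-map-const : ∀ {xs} → All (λ a → f a ≡ c) xs → sum (map f xs) ≡ length xs * c
  sum-map-const []           = refl
  sum-map-const (fa≡c ∷ f≡c) = cong₂ _+_ fa≡c (sum-map-const f≡c)

  length≤sum-map : ∀ {xs} → All (λ a → 1 ≤ f a) xs → length xs ≤ sum (map f xs)
  length≤sum-map []           = z≤n
  length≤sum-map (1≤fa ∷ 1≤f) = +-mono-≤ 1≤fa (length≤sum-map 1≤f)

  length≤1+sum-map : ∀ {xs} {a₀ : A} → Unique xs → All (λ a → f a ≡ 0 → a ≡ a₀) xs →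
                     length xs ≤ suc (sum (map f xs))
  length≤1+sum-map [] [] = z≤n
  length≤1+sum-map {a ∷ as} {a₀} (a∉as ∷ unique) (zero⇒a₀ ∷ zeros⇒a₀) with f a
  ... | suc k = s≤s (≤-trans (length≤1+sum-map unique zeros⇒a₀) (s≤s (m≤n+m _ k)))
  ... | zero  = s≤s (length≤sum-map (All.zipWith positive (a∉as , zeros⇒a₀)))
    where
    positive : ∀ {b} → a ≢ b × (f b ≡ 0 → b ≡ a₀) → 1 ≤ f b
    positive (a≢b , zero⇒b≡a₀) = n≢0⇒n>0 λ fb≡0 → a≢b (trans (zero⇒a₀ refl) (sym (zero⇒b≡a₀ fb≡0)))

module _ (g : A → Subset n) where

  PairwiseDisjoint : List A → Set
  PairwiseDisjoint xs = ∀ {a b} → a ∈ₗ xs → b ∈ₗ xs → a ≢ b → Empty (g a ∩ g b)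

  ∈⋃⁻ : ∀ xs → x ∈ ⋃ (map g xs) → ∃ λ a → a ∈ₗ xs × x ∈ g a
  ∈⋃⁻ []       x∈⋃ = ⊥-elim (∉⊥ x∈⋃)
  ∈⋃⁻ (a ∷ as) x∈⋃ with x∈p∪q⁻ (g a) _ x∈⋃
  ... | inj₁ x∈ga  = a , hereₗ refl , x∈ga
  ... | inj₂ x∈⋃as = let (b , b∈as , x∈gb) = ∈⋃⁻ as x∈⋃as in b , thereₗ b∈as , x∈gb

  ∈⋃⁺ : ∀ {a xs} → a ∈ₗ xs → x ∈ g a → x ∈ ⋃ (map g xs)
  ∈⋃⁺ (hereₗ refl) x∈ga = x∈p∪q⁺ (inj₁ x∈ga)
  ∈⋃⁺ (thereₗ a∈)  x∈ga = x∈p∪q⁺ (inj₂ (∈⋃⁺ a∈ x∈ga))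

  ∣⋃∣≤sum : ∀ xs → ∣ ⋃ (map g xs) ∣ ≤ sum (map (∣_∣ ∘ g) xs)
  ∣⋃∣≤sum []       = ≤-reflexive (∣⊥∣≡0 n)
  ∣⋃∣≤sum (a ∷ as) = ≤-trans (∣p∪q∣≤∣p∣+∣q∣ (g a) _) (+-monoʳ-≤ ∣ g a ∣ (∣⋃∣≤sum as))

  ∣⋃∣≡sum : ∀ {xs} → Unique xs → PairwiseDisjoint xs →
            ∣ ⋃ (map g xs) ∣ ≡ sum (map (∣_∣ ∘ g) xs)
  ∣⋃∣≡sum {[]}     []              _        = ∣⊥∣≡0 n
  ∣⋃∣≡sum {a ∷ as} (a∉as ∷ unique) disjoint =
    trans (Empty[p∩q]⇒∣p∪q∣≡∣p∣+∣q∣ (g a) _ ga∩⋃as-empty)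
          (cong (∣ g a ∣ +_) (∣⋃∣≡sum unique λ b∈ c∈ → disjoint (thereₗ b∈) (thereₗ c∈)))
    where
    ga∩⋃as-empty : Empty (g a ∩ ⋃ (map g as))
    ga∩⋃as-empty (z , z∈) =
      let (z∈ga , z∈⋃as)   = x∈p∩q⁻ (g a) _ z∈
          (b , b∈as , z∈gb) = ∈⋃⁻ as z∈⋃as
      in disjoint (hereₗ refl) (thereₗ b∈as) (All.lookup a∉as b∈as) (z , x∈p∩q⁺ (z∈ga , z∈gb))

  disjoint-sum≤ : ∀ {xs} {p : Subset n} → Unique xs → PairwiseDisjoint xs →
                  (∀ {a} → a ∈ₗ xs → g a ⊆ p) → sum (map (∣_∣ ∘ g) xs) ≤ ∣ p ∣
  disjoint-sum≤ {xs = xs} {p = p} unique disjoint g⊆p = begin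
    sum (map (∣_∣ ∘ g) xs)  ≡⟨ ∣⋃∣≡sum unique disjoint ⟨
    ∣ ⋃ (map g xs) ∣         ≤⟨ p⊆q⇒∣p∣≤∣q∣ ⋃⊆p ⟩
    ∣ p ∣                    ∎
    where
    open ≤-Reasoning
    ⋃⊆p : ⋃ (map g xs) ⊆ p
    ⋃⊆p z∈⋃ = let (a , a∈xs , z∈ga) = ∈⋃⁻ xs z∈⋃ in g⊆p a∈xs z∈ga

sunflower-bound : ∀ {s} (ℓ : Fin s → Subset n) → x ≢ y →
                  (∀ i → x ∈ ℓ i) → (∀ i → y ∈ ℓ i) → (∀ i → ∣ ℓ i ∣ ≡ 2 + c) →
                  (∀ i j → i ≢ j → ∣ ℓ i ∩ ℓ j ∣ ≤ 2) →
                  2 + s * c ≤ n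
sunflower-bound {n = n} {x = x} {y = y} {c = c} {s} ℓ x≢y x∈ℓ y∈ℓ ∣ℓ∣≡2+c ∣ℓ∩ℓ∣≤2 = begin
  2 + s * c                               ≡⟨ cong (2 +_) ∑∣petal∣≡s*c ⟨
  2 + sum (map (∣_∣ ∘ petal) (allFin s))  ≤⟨ +-monoʳ-≤ 2 ∑∣petal∣≤∣⊤-x-y∣ ⟩
  2 + ∣ ⊤ - x - y ∣                       ≡⟨ x,y∈p⇒2+∣p-x-y∣≡∣p∣ (∈⊤ {x = x}) (∈⊤ {x = y}) x≢y ⟩
  ∣ ⊤ {n} ∣                               ≡⟨ ∣⊤∣≡n n ⟩
  n                                       ∎
  where
  open ≤-Reasoning
  petal : Fin s → Subset n
  petal i = ℓ i - x - y

  ∣petal∣≡c : ∀ i → ∣ petal i ∣ ≡ c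
  ∣petal∣≡c i = +-cancelˡ-≡ 2 _ _ (trans (x,y∈p⇒2+∣p-x-y∣≡∣p∣ (x∈ℓ i) (y∈ℓ i) x≢y) (∣ℓ∣≡2+c i))

  ∑∣petal∣≡s*c : sum (map (∣_∣ ∘ petal) (allFin s)) ≡ s * c
  ∑∣petal∣≡s*c =
    trans (sum-map-const (∣_∣ ∘ petal) {xs = allFin s} (All.tabulate λ {i} _ → ∣petal∣≡c i))
          (cong (_* c) (length-tabulate {n = s} id))

  z∈petal⇒z≢x : ∀ {i} → z ∈ petal i → z ≢ x
  z∈petal⇒z≢x = x∈p-y⇒x≢y ∘ p─q⊆p _ _

  z∈petal⇒z∈ℓ : ∀ {i} → z ∈ petal i → z ∈ ℓ i
  z∈petal⇒z∈ℓ = p─q⊆p _ _ ∘ p─q⊆p _ _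

  petals-disjoint : PairwiseDisjoint petal (allFin s)
  petals-disjoint {i} {j} _ _ i≢j (z , z∈) =
    let (z∈i , z∈j) = x∈p∩q⁻ (petal i) _ z∈
    in <⇒≱ (n<1+n 2) (≤-trans
         (distinct-triple⇒3≤∣p∣ (x∈p∩q⁺ (x∈ℓ i , x∈ℓ j)) (x∈p∩q⁺ (y∈ℓ i , y∈ℓ j))
            (x∈p∩q⁺ (z∈petal⇒z∈ℓ z∈i , z∈petal⇒z∈ℓ z∈j))
            x≢y (≢-sym (z∈petal⇒z≢x z∈i)) (≢-sym (x∈p-y⇒x≢y z∈i)))
         (∣ℓ∩ℓ∣≤2 i j i≢j))

  petal⊆ : ∀ {i} → i ∈ₗ allFin s → petal i ⊆ ⊤ - x - y
  petal⊆ _ z∈ = x∈p∧x≢y⇒x∈p-y (x∈p∧x≢y⇒x∈p-y ∈⊤ (z∈petal⇒z≢x z∈)) (x∈p-y⇒x≢y z∈)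

  ∑∣petal∣≤∣⊤-x-y∣ : sum (map (∣_∣ ∘ petal) (allFin s)) ≤ ∣ ⊤ - x - y ∣
  ∑∣petal∣≤∣⊤-x-y∣ = disjoint-sum≤ petal (allFin⁺ s) petals-disjoint petal⊆

orthogoval-bound : ∀ {s} (P : Fin s → Plane n) →
                   (∀ i → UniqueLineAxiom (P i)) → (∀ i → LinesOfSize (2 + c) (P i)) →
                   MutuallyOrthogoval P → {x y : Fin n} → x ≢ y → 2 + s * c ≤ n
orthogoval-bound {n = n} {s = s} P join size orthogoval {x} {y} x≢y =
  sunflower-bound ℓ x≢y (proj₁ ∘ x,y∈ℓ) (proj₂ ∘ x,y∈ℓ)
    (λ i → size i (ℓ i) (ℓ∈P i))
    (λ i j i≢j → orthogoval i j i≢j (ℓ i) (ℓ j) (ℓ∈P i) (ℓ∈P j))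
  where
  line : ∀ i → ∃ λ ℓ → ℓ ∈ₗ P i × x ∈ ℓ × y ∈ ℓ
  line i = proj₁ (join i x y x≢y)

  ℓ : Fin s → Subset n
  ℓ = proj₁ ∘ line

  ℓ∈P : ∀ i → ℓ i ∈ₗ P i
  ℓ∈P = proj₁ ∘ proj₂ ∘ line

  x,y∈ℓ : ∀ i → x ∈ ℓ i × y ∈ ℓ i
  x,y∈ℓ = proj₂ ∘ proj₂ ∘ line

pencil : Plane n → Fin n → List (Subset n)
pencil L x = filter (x ∈?_) L

points≤1+pencil*c : UniqueLineAxiom L → LinesOfSize (suc c) L → (x : Fin n) →
                    n ≤ suc (length (pencil L x) * c)
points≤1+pencil*c {n = n} {L = L} {c = c} join size x = begin
  n                                            ≡⟨ ∣⊤∣≡n n ⟨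
  ∣ ⊤ {n} ∣                                    ≡⟨ x∈p⇒suc∣p-x∣≡∣p∣ (∈⊤ {x = x}) ⟨
  suc ∣ ⊤ - x ∣                                ≤⟨ s≤s (p⊆q⇒∣p∣≤∣q∣ covered) ⟩
  suc ∣ ⋃ (map (_- x) (pencil L x)) ∣          ≤⟨ s≤s (∣⋃∣≤sum (_- x) (pencil L x)) ⟩
  suc (sum (map (∣_∣ ∘ (_- x)) (pencil L x)))  ≡⟨ cong suc (sum-map-const (∣_∣ ∘ (_- x)) ∣ℓ-x∣≡c) ⟩
  suc (length (pencil L x) * c)                ∎
  where
  open ≤-Reasoning
  ∣ℓ-x∣≡c : All (λ ℓ → ∣ ℓ - x ∣ ≡ c) (pencil L x)
  ∣ℓ-x∣≡c = All.tabulate λ ℓ∈ → let (ℓ∈L , x∈ℓ) = ∈-filter⁻ (x ∈?_) ℓ∈ in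
    suc-injective (trans (x∈p⇒suc∣p-x∣≡∣p∣ x∈ℓ) (size _ ℓ∈L))

  covered : ⊤ - x ⊆ ⋃ (map (_- x) (pencil L x))
  covered {z} z∈ =
    let z≢x = x∈p-y⇒x≢y z∈
        ((ℓ , ℓ∈L , x∈ℓ , z∈ℓ) , _) = join x z (≢-sym z≢x)
    in ∈⋃⁺ (_- x) (∈-filter⁺ (x ∈?_) ℓ∈L x∈ℓ) (x∈p∧x≢y⇒x∈p-y z∈ℓ z≢x)

pencil-meets-sum≤ : UniqueLineAxiom L → Unique L → x ∉ m →
                    sum (map (λ ℓ → ∣ m ∩ ℓ ∣) (pencil L x)) ≤ ∣ m ∣
pencil-meets-sum≤ {L = L} {x = x} {m = m} join unique x∉m =
  disjoint-sum≤ (m ∩_) (filter⁺ (x ∈?_) unique) meets-disjoint (λ _ → p∩q⊆p m _)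
  where
  meets-disjoint : PairwiseDisjoint (m ∩_) (pencil L x)
  meets-disjoint a∈ b∈ a≢b (z , z∈) =
    let (a∈L , x∈a) = ∈-filter⁻ (x ∈?_) a∈
        (b∈L , x∈b) = ∈-filter⁻ (x ∈?_) b∈
        (z∈m∩a , z∈m∩b) = x∈p∩q⁻ _ _ z∈
        (z∈m , z∈a) = x∈p∩q⁻ m _ z∈m∩a
        z∈b = proj₂ (x∈p∩q⁻ m _ z∈m∩b)
        x≢z : x ≢ z
        x≢z x≡z = x∉m (subst (_∈ m) (sym x≡z) z∈m)
    in a≢b (proj₂ (join x z x≢z) _ _ a∈L b∈L x∈a z∈a x∈b z∈b)

noncollinear⇒point-off-line : UniqueLineAxiom L → y ≢ z → ¬ Collinear L x y z →
                              ∃ λ m → m ∈ₗ L × x ∉ m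
noncollinear⇒point-off-line join y≢z ¬xyz =
  let ((m , m∈L , y∈m , z∈m) , _) = join _ _ y≢z
  in m , m∈L , λ x∈m → ¬xyz (m , m∈L , x∈m , y∈m , z∈m)

projective-pencil≤ : {L : Plane n} {m : Subset n} {x : Fin n} →
                     IsProjectivePlane q L → m ∈ₗ L → x ∉ m → length (pencil L x) ≤ suc q
projective-pencil≤ {q = q} {L = L} {m = m} {x = x} π m∈L x∉m = begin
  length (pencil L x)                       ≤⟨ length≤sum-map (λ ℓ → ∣ m ∩ ℓ ∣) all-meet ⟩
  sum (map (λ ℓ → ∣ m ∩ ℓ ∣) (pencil L x))  ≤⟨ pencil-meets-sum≤ joinAxiom distinctLines x∉m ⟩
  ∣ m ∣                                     ≡⟨ order m m∈L ⟩
  suc q                                     ∎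
  where
  open ≤-Reasoning
  open IsProjectivePlane π

  all-meet : All (λ ℓ → 1 ≤ ∣ m ∩ ℓ ∣) (pencil L x)
  all-meet = All.tabulate λ ℓ∈ → let (ℓ∈L , x∈ℓ) = ∈-filter⁻ (x ∈?_) ℓ∈ in
    ≤-reflexive (sym (meetAxiom m _ m∈L ℓ∈L λ m≡ℓ → x∉m (subst (x ∈_) (sym m≡ℓ) x∈ℓ)))

affine-pencil≤ : {L : Plane n} {m : Subset n} {x : Fin n} →
                 IsAffinePlane q L → m ∈ₗ L → x ∉ m → length (pencil L x) ≤ suc q
affine-pencil≤ {n} {q = q} {L = L} {m = m} {x = x} α m∈L x∉m = begin
  length (pencil L x)                             ≤⟨ length≤1+sum-map (λ ℓ → ∣ m ∩ ℓ ∣)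
                                                        unique-pencil only-parallel-misses ⟩
  suc (sum (map (λ ℓ → ∣ m ∩ ℓ ∣) (pencil L x)))  ≤⟨ s≤s (pencil-meets-sum≤ joinAxiom distinctLines x∉m) ⟩
  suc ∣ m ∣                                       ≡⟨ cong suc (order m m∈L) ⟩
  suc q                                           ∎
  where
  open ≤-Reasoning
  open IsAffinePlane α

  unique-pencil : Unique (pencil L x)
  unique-pencil = filter⁺ (x ∈?_) distinctLines

  parallel : Subset n
  parallel = proj₁ (proj₁ (parallelAxiom x m m∈L x∉m))

  only-parallel-misses : All (λ ℓ → ∣ m ∩ ℓ ∣ ≡ 0 → ℓ ≡ parallel) (pencil L x)
  only-parallel-misses = All.tabulate λ ℓ∈ m∩ℓ≡0 →
    let (ℓ∈L , x∈ℓ) = ∈-filter⁻ (x ∈?_) ℓ∈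
        ((_ , p∈L , x∈p , m∩p≡0) , unique) = parallelAxiom x m m∈L x∉m
    in sym (unique _ _ p∈L ℓ∈L x∈p x∈ℓ m∩p≡0 m∩ℓ≡0)

projective-points≤ : {L : Plane n} → IsProjectivePlane q L → n ≤ 1 + suc q * q
projective-points≤ {q = q} π =
  let (x , _ , _ , _ , (_ , _ , _ , y≢z , _) , ¬xyz , _) = quadrangle
      (m , m∈L , x∉m) = noncollinear⇒point-off-line joinAxiom y≢z ¬xyz
  in ≤-trans (points≤1+pencil*c joinAxiom order x)
             (s≤s (*-monoˡ-≤ q (projective-pencil≤ π m∈L x∉m)))
  where open IsProjectivePlane π

affine-points≤ : {L : Plane n} → IsAffinePlane (suc c) L → n ≤ 1 + suc (suc c) * c
affine-points≤ {c = c} α =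
  let (x , _ , _ , (_ , _ , y≢z) , ¬xyz) = triangle
      (m , m∈L , x∉m) = noncollinear⇒point-off-line joinAxiom y≢z ¬xyz
  in ≤-trans (points≤1+pencil*c joinAxiom order x)
             (s≤s (*-monoˡ-≤ c (affine-pencil≤ α m∈L x∉m)))
  where open IsAffinePlane α

2+s*a≤1+[1+t]*a⇒s≤t : ∀ s t a → 2 + s * a ≤ 1 + suc t * a → s ≤ t
2+s*a≤1+[1+t]*a⇒s≤t s t a h = s≤s⁻¹ (*-cancelʳ-< a s (suc t) (s≤s⁻¹ h))

projective-order-bound : ∀ r s → 2 + s * suc r ≤ 1 + (3 + r) * (2 + r) → s ≤ 5 ⊔ (2 + r + 2)
projective-order-bound zero    s h = m≤n⇒m≤n⊔o 4 (2+s*a≤1+[1+t]*a⇒s≤t s 5 1 h)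
projective-order-bound (suc r) s h =
  m≤n⇒m≤o⊔n 5 (2+s*a≤1+[1+t]*a⇒s≤t s (2 + suc r + 2) (2 + r) (≤-trans h (s≤s points≤)))
  where
  expand : ∀ r → (4 + r) * (3 + r) + r ≡ suc (2 + suc r + 2) * (2 + r)
  expand = solve-∀

  points≤ : (4 + r) * (3 + r) ≤ suc (2 + suc r + 2) * (2 + r)
  points≤ = ≤-trans (m≤m+n _ r) (≤-reflexive (expand r))

affine-order-bound : ∀ r s → 2 + s * suc r ≤ 1 + (4 + r) * (2 + r) → s ≤ 7 ⊔ (3 + r + 2)
affine-order-bound zero          s h = m≤n⇒m≤n⊔o 5 (2+s*a≤1+[1+t]*a⇒s≤t s 7 1 h)
affine-order-bound (suc zero)    s h = m≤n⇒m≤n⊔o 6 (2+s*a≤1+[1+t]*a⇒s≤t s 7 2 (≤-trans h (n≤1+n _)))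
affine-order-bound (suc (suc r)) s h =
  m≤n⇒m≤o⊔n 7 (2+s*a≤1+[1+t]*a⇒s≤t s (3 + suc (suc r) + 2) (3 + r) (≤-trans h (s≤s points≤)))
  where
  expand : ∀ r → (6 + r) * (4 + r) + r ≡ suc (3 + suc (suc r) + 2) * (3 + r)
  expand = solve-∀

  points≤ : (6 + r) * (4 + r) ≤ suc (3 + suc (suc r) + 2) * (3 + r)
  points≤ = ≤-trans (m≤m+n _ r) (≤-reflexive (expand r))

projective-orthogoval-bound : ∀ (q n s : ℕ) (P : Fin s → Plane n) → 2 ≤ q →
                              (∀ i → IsProjectivePlane q (P i)) → MutuallyOrthogoval P →
                              s ≤ 5 ⊔ (q + 2)
projective-orthogoval-bound q n zero P _ _ _ = z≤n
projective-orthogoval-bound (suc (suc r)) n (suc s) P (s≤s (s≤s _)) planes orthogoval =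
  let (x , y , _ , _ , (x≢y , _) , _) = quadrangle (planes zero)
  in projective-order-bound r (suc s) (≤-trans
       (orthogoval-bound P (joinAxiom ∘ planes) (order ∘ planes) orthogoval x≢y)
       (projective-points≤ (planes zero)))
  where open IsProjectivePlane

affine-orthogoval-bound : ∀ (q n s : ℕ) (P : Fin s → Plane n) → 2 < q →
                          (∀ i → IsAffinePlane q (P i)) → MutuallyOrthogoval P →
                          s ≤ 7 ⊔ (q + 2)
affine-orthogoval-bound q n zero P _ _ _ = z≤n
affine-orthogoval-bound (suc (suc (suc r))) n (suc s) P (s≤s (s≤s (s≤s _))) planes orthogoval =
  let (x , y , _ , (x≢y , _) , _) = triangle (planes zero)
  in affine-order-bound r (suc s) (≤-trans
       (orthogoval-bound P (joinAxiom ∘ planes) (order ∘ planes) orthogoval x≢y)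
       (affine-points≤ (planes zero)))
  where open IsAffinePlane

corollary1p3 : (∀ (q n s : ℕ) (P : Fin s → Plane n) → 2 ≤ q →
    (∀ i → IsProjectivePlane q (P i)) → MutuallyOrthogoval P →
    s ≤ 5 ⊔ (q + 2))
    ×
    (∀ (q n s : ℕ) (P : Fin s → Plane n) → 2 < q →
    (∀ i → IsAffinePlane q (P i)) → MutuallyOrthogoval P →
    s ≤ 7 ⊔ (q + 2))
corollary1p3 = projective-orthogoval-bound , affine-orthogoval-bound
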